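{- Let $e_1,e_2$ be integers with $e_1\ge e_2>1$, and let $P=\{\{a^{e_1}\},\{\hat a^{e_2}\},\{\hat a\}\}$. If $\gcd(e_1+1,-e_2+1)=1$, then $P$ realizes a graph of order $n$ for every integer \[ n\ge \max\left\{\frac{(e_1+1)(e_1+e_2)}{e_1},\ \frac{(e_2-1)(e_1+e_2)}{e_2}\right\}. \]
   Context: Graphs are loopless multigraphs; the order of a graph is its number of vertices. A tile is a vertex with half-edges (cohesive ends) labeled by letters; $\{a^{e}\}$ denotes a tile with $e$ cohesive ends of type $a$, and $\{\hat a^{e}\}$ a tile with $e$ cohesive ends of the complementary type $\hat a$. A pot is a set of tile types. A graph $G$ is realized by a pot $P$ if each vertex $v$ can be assigned a tile type $t\in P$ together with a bijection between the cohesive ends of $t$ and the edge-ends (half-edges) at $v$, such that for every edge the two half-edges are assigned complementary cohesive ends ($a$ and $\hat a$). -}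

module Defs where

open import Data.Nat using (ℕ)
open import Data.Bool using (Bool; true; false; not)
open import Data.Fin using (Fin)
open import Data.List using (List; length; lookup; replicate; _∷_; [])
open import Data.List.Membership.Propositional using (_∈_)
open import Data.Product using (Σ; _×_; _,_; proj₁; proj₂; ∃)
open import Function.Bundles using (_↔_; Inverse)
open import Relation.Binary.PropositionalEquality using (_≡_; _≢_; refl)

-- A cohesive-end type: a letter (ℕ) together with a flag; (x , false) is
-- the letter x, (x , true) is its complement x̂.
CohesiveEnd : Set
CohesiveEnd = ℕ × Bool

Complementary : CohesiveEnd → CohesiveEnd → Set
Complementary (x , b) (y , c) = (x ≡ y) × (c ≡ not b)

-- A tile type: its (multi)set of cohesive ends, listed.
Tile : Set
Tile = List CohesiveEnd

Pot : Set
Pot = List Tile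

-- A loopless multigraph of order n: vertices Fin n, a list of edges
-- (parallel edges allowed), each edge joining two distinct vertices.
record Graph (n : ℕ) : Set where
  field
    edges    : List (Fin n × Fin n)
    loopless : (i : Fin (length edges)) →
               proj₁ (lookup edges i) ≢ proj₂ (lookup edges i)

  HalfEdge : Set
  HalfEdge = Fin (length edges) × Bool

  endpoint : HalfEdge → Fin n
  endpoint (i , false) = proj₁ (lookup edges i)
  endpoint (i , true)  = proj₂ (lookup edges i)

  HalfEdgesAt : Fin n → Set
  HalfEdgesAt v = Σ HalfEdge (λ h → endpoint h ≡ v)

record Realization {n : ℕ} (P : Pot) (G : Graph n) : Set where
  open Graph G
  field
    tile    : Fin n → Tile
    tile∈P  : (v : Fin n) → tile v ∈ P
    assign  : (v : Fin n) → Fin (length (tile v)) ↔ HalfEdgesAt v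

  label : HalfEdge → CohesiveEnd
  label h = lookup (tile (endpoint h)) (Inverse.from (assign (endpoint h)) (h , refl))

  field
    complementary : (i : Fin (length edges)) →
                    Complementary (label (i , false)) (label (i , true))

RealizesOrder : Pot → ℕ → Set
RealizesOrder P n = Σ (Graph n) (λ G → Realization P G)

a : ℕ
a = 0

aTile : ℕ → Tile
aTile e = replicate e (a , false)

âTile : ℕ → Tile
âTile e = replicate e (a , true)

-- Realizing order n means choosing x tiles {a^e₁}, y tiles {â^e₂} and z tiles {â} with
-- x + y + z = n and as many a-ends as â-ends, x e₁ = y e₂ + z; any such choice is realized by
-- the bipartite multigraph joining the a-ends one by one to the â-ends. Eliminating z, the
-- condition reads x (e₁ + 1) = y (e₂ - 1) + n. As e₁ + 1 and e₂ - 1 are coprime, some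
-- y ≤ e₁ makes the right-hand side divisible by e₁ + 1, which determines x, and the first
-- lower bound on n makes z = n - x - y nonnegative.
module Submission where

open import Defs
open import Axiom.UniquenessOfIdentityProofs.WithK using (uip)
open import Data.Bool using (Bool; true; false)
open import Data.Fin using (Fin; zero; suc; cast; quotient)
open import Data.Fin.Properties using (cast-involutive; *↔×; +↔⊎)
open import Data.List using (List; length; lookup; replicate; tabulate; _∷_; [])
open import Data.List.Properties using (length-tabulate; lookup-tabulate; length-replicate; lookup-replicate)
open import Data.List.Membership.Propositional using (_∈_)
open import Data.List.Relation.Unary.Any using (here; there)
open import Data.Nat using (ℕ; suc; s≤s)
open import Data.Nat.Coprimality using (Coprime; coprime-Bézout; gcd≡1⇒coprime)
open import Data.Product using (Σ; _×_; _,_; proj₁; proj₂; ∃-syntax)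
open import Data.Sum using (_⊎_; inj₁; inj₂; [_,_]′) renaming (map to ⊎-map)
open import Data.Sum.Function.Propositional using (_⊎-↔_)
open import Function using (_∘_; id)
open import Function.Bundles using (_↔_; Inverse; mk↔ₛ′)
open import Function.Construct.Composition using (_↔-∘_)
open import Function.Construct.Identity using (↔-id)
open import Function.Construct.Symmetry using (↔-sym)
open import Function.Related.Propositional using (module EquationalReasoning)
open import Relation.Binary.PropositionalEquality

private variable
  A B C D : Set

-- ℕ arithmetic is opened only locally, keeping the ℤ operators of theorem2 unambiguous.
module _ where

  open import Data.Nat
  open import Data.Nat.Properties
  open import Data.Nat.DivMod using (_%_; _/_; m≡m%n+[m/n]*n; m%n<n)
  open import Data.Nat.Divisibility using (_∣_; divides; ∣m+n∣m⇒∣n; ∣n⇒∣m*n; n∣m*n)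
  open import Data.Nat.GCD using (module Bézout)
  open import Data.Nat.Tactic.RingSolver using (solve)

  record TileCounts (e₁ e₂ n : ℕ) : Set where
    field
      x y z   : ℕ
      order   : n ≡ x + (y + z)
      balance : x * e₁ ≡ y * e₂ + z

  coprime⇒∃[u]∣u*k+1 : ∀ {e k} → Coprime (suc e) k → ∃[ u ] suc e ∣ u * k + 1
  coprime⇒∃[u]∣u*k+1 {e} {k} coprime with coprime-Bézout coprime
  ... | Bézout.+- x y eq = y , divides x (trans (+-comm (y * k) 1) eq)
  ... | Bézout.-+ x y eq = e * y , divides (1 + e * x) (begin
    e * y * k + 1             ≡⟨ cong (_+ 1) (*-assoc e y k) ⟩
    e * (y * k) + 1           ≡⟨ cong (λ t → e * t + 1) eq ⟨
    e * (1 + x * suc e) + 1   ≡⟨ solve (e ∷ x ∷ []) ⟩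
    (1 + e * x) * suc e       ∎)
    where open ≡-Reasoning

  ∣y*k+n : ∀ {m} k u n y q → m ∣ u * k + 1 → n * u ≡ y + q * m → m ∣ y * k + n
  ∣y*k+n {m} k u n y q m∣uk+1 nu≡y+qm =
    ∣m+n∣m⇒∣n (subst (m ∣_) expand (∣n⇒∣m*n n m∣uk+1)) (n∣m*n (q * k))
    where
    open ≡-Reasoning
    expand : n * (u * k + 1) ≡ q * k * m + (y * k + n)
    expand = begin
      n * (u * k + 1)           ≡⟨ solve (n ∷ u ∷ k ∷ []) ⟩
      n * u * k + n             ≡⟨ cong (λ t → t * k + n) nu≡y+qm ⟩
      (y + q * m) * k + n       ≡⟨ solve (y ∷ q ∷ m ∷ k ∷ n ∷ []) ⟩
      q * k * m + (y * k + n)   ∎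

  ∃[y<m]∣y*k+n : ∀ {m k u} n .{{_ : NonZero m}} → m ∣ u * k + 1 → ∃[ y ] y < m × m ∣ y * k + n
  ∃[y<m]∣y*k+n {m} {k} {u} n m∣uk+1 = n * u % m , m%n<n (n * u) m ,
    ∣y*k+n k u n (n * u % m) (n * u / m) m∣uk+1 (m≡m%n+[m/n]*n (n * u) m)

  residue⇒x+y≤n : ∀ {e₁} k n x y → y ≤ e₁ → y * k + n ≡ x * suc e₁ →
                  e₁ * (e₁ + suc k) ≤ n * e₁ → x + y ≤ n
  residue⇒x+y≤n {e₁} k n x y y≤e₁ residue bound = *-cancelʳ-≤ (x + y) n (suc e₁) (begin
    (x + y) * suc e₁          ≡⟨ *-distribʳ-+ (suc e₁) x y ⟩
    x * suc e₁ + y * suc e₁   ≡⟨ cong (_+ y * suc e₁) residue ⟨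
    y * k + n + y * suc e₁    ≡⟨ solve (y ∷ k ∷ n ∷ e₁ ∷ []) ⟩
    y * (e₁ + suc k) + n      ≤⟨ +-monoˡ-≤ n (*-monoˡ-≤ (e₁ + suc k) y≤e₁) ⟩
    e₁ * (e₁ + suc k) + n     ≤⟨ +-monoˡ-≤ n bound ⟩
    n * e₁ + n                ≡⟨ solve (n ∷ e₁ ∷ []) ⟩
    n * suc e₁                ∎)
    where open ≤-Reasoning

  residue⇒balance : ∀ {e₁} k n x y z → y * k + n ≡ x * suc e₁ → n ≡ x + (y + z) →
                    x * e₁ ≡ y * suc k + z
  residue⇒balance {e₁} k n x y z residue order = +-cancelˡ-≡ x _ _ (begin
    x + x * e₁                ≡⟨ *-suc x e₁ ⟨
    x * suc e₁                ≡⟨ residue ⟨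
    y * k + n                 ≡⟨ cong (y * k +_) order ⟩
    y * k + (x + (y + z))     ≡⟨ solve (y ∷ k ∷ x ∷ z ∷ []) ⟩
    x + (y * suc k + z)       ∎)
    where open ≡-Reasoning

  tileCounts-from-residue : ∀ {e₁} k n x y → y ≤ e₁ → y * k + n ≡ x * suc e₁ →
                            e₁ * (e₁ + suc k) ≤ n * e₁ → TileCounts e₁ (suc k) n
  tileCounts-from-residue {e₁} k n x y y≤e₁ residue bound
    with z , x+y+z≡n ← m≤n⇒∃[o]m+o≡n (residue⇒x+y≤n k n x y y≤e₁ residue bound)
    = record { x = x ; y = y ; z = z ; order = order
             ; balance = residue⇒balance k n x y z residue order }
    where
    order : n ≡ x + (y + z)
    order = trans (sym x+y+z≡n) (+-assoc x y z)

  tileCounts : ∀ {e₁ k} n → Coprime (suc e₁) k →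
               suc e₁ * (e₁ + suc k) ≤ n * e₁ → TileCounts e₁ (suc k) n
  tileCounts {e₁} {k} n coprime bound
    with u , m∣uk+1 ← coprime⇒∃[u]∣u*k+1 coprime
    with y , y<m , divides x residue ← ∃[y<m]∣y*k+n {u = u} n m∣uk+1
    = tileCounts-from-residue k n x y (s≤s⁻¹ y<m) residue
        (≤-trans (m≤n+m (e₁ * (e₁ + suc k)) (e₁ + suc k)) bound)

Fiber : (A → B) → B → Set
Fiber {A} h b = Σ A λ a → h a ≡ b

fiber-≡ : {h : A → B} {b : B} {a a′ : A} {p : h a ≡ b} {p′ : h a′ ≡ b} →
          a ≡ a′ → _≡_ {A = Fiber h b} (a , p) (a′ , p′)
fiber-≡ refl = cong (_ ,_) (uip _ _)

fiber-reindex : (φ : A ↔ B) {h : B → C} {h′ : A → C} {c : C} →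
                (∀ a → h′ a ≡ h (Inverse.to φ a)) → Fiber h′ c ↔ Fiber h c
fiber-reindex φ {h} {h′} {c} h′≗h∘φ = mk↔ₛ′ forth back
  (λ (b , _) → fiber-≡ (strictlyInverseˡ b))
  (λ (a , _) → fiber-≡ (strictlyInverseʳ a))
  where
  open Inverse φ using (to; from; strictlyInverseˡ; strictlyInverseʳ)
  forth : Fiber h′ c → Fiber h c
  forth (a , p) = to a , trans (sym (h′≗h∘φ a)) p
  back : Fiber h c → Fiber h′ c
  back (b , p) = from b , (begin
    h′ (from b)     ≡⟨ h′≗h∘φ (from b) ⟩
    h (to (from b)) ≡⟨ cong h (strictlyInverseˡ b) ⟩
    h b             ≡⟨ p ⟩
    c               ∎)
    where open ≡-Reasoning

fiber-from∘ : (ι : B ↔ C) {h : A → C} {b : B} →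
              Fiber (Inverse.from ι ∘ h) b ↔ Fiber h (Inverse.to ι b)
fiber-from∘ ι {h} {b} = mk↔ₛ′ forth back (λ _ → fiber-≡ refl) (λ _ → fiber-≡ refl)
  where
  open Inverse ι using (to; from; strictlyInverseˡ; strictlyInverseʳ)
  forth : Fiber (from ∘ h) b → Fiber h (to b)
  forth (a , p) = a , trans (sym (strictlyInverseˡ (h a))) (cong to p)
  back : Fiber h (to b) → Fiber (from ∘ h) b
  back (a , p) = a , trans (cong from p) (strictlyInverseʳ b)

fiber-⊎-map : {h₁ : A → C} {h₂ : B → D} (s : C ⊎ D) →
              Fiber (⊎-map h₁ h₂) s ↔ [ Fiber h₁ , Fiber h₂ ]′ s
fiber-⊎-map (inj₁ a) = mk↔ₛ′
  (λ { (inj₁ a , refl) → a , refl })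
  (λ (a , p) → inj₁ a , cong inj₁ p)
  (λ { (a , refl) → refl })
  (λ { (inj₁ a , refl) → refl })
fiber-⊎-map (inj₂ b) = mk↔ₛ′
  (λ { (inj₂ b , refl) → b , refl })
  (λ (b , p) → inj₂ b , cong inj₂ p)
  (λ { (b , refl) → refl })
  (λ { (inj₂ b , refl) → refl })

fiber-quotient : ∀ {m} k (j : Fin m) → Fiber (quotient k) j ↔ Fin k
fiber-quotient {m} k j = begin
  Fiber (quotient k) j      ↔⟨ fiber-reindex (*↔× {m} {k}) (λ _ → refl) ⟩
  Fiber proj₁ j             ↔⟨ fiber-proj₁ ⟩
  Fin k                     ∎
  where
  open EquationalReasoning
  fiber-proj₁ : Fiber {Fin m × Fin k} proj₁ j ↔ Fin k
  fiber-proj₁ = mk↔ₛ′ (λ ((_ , r) , _) → r) (λ r → (j , r) , refl)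
    (λ _ → refl) (λ { ((_ , r) , refl) → refl })

fiber-id : (a : A) → Fiber id a ↔ Fin 1
fiber-id a = mk↔ₛ′ (λ _ → zero) (λ _ → a , refl)
  (λ { zero → refl ; (suc ()) }) (λ { (_ , refl) → refl })

cast↔ : ∀ {m n} → m ≡ n → Fin m ↔ Fin n
cast↔ m≡n = mk↔ₛ′ (cast m≡n) (cast (sym m≡n))
  (cast-involutive m≡n (sym m≡n)) (cast-involutive (sym m≡n) m≡n)

lookup-replicate′ : ∀ d (c : A) j → lookup (replicate d c) j ≡ c
lookup-replicate′ d c j = begin
  lookup (replicate d c) j
    ≡⟨ cong (lookup (replicate d c)) (cast-involutive (sym L) L j) ⟨
  lookup (replicate d c) (cast (sym L) (cast L j))
    ≡⟨ lookup-replicate d c (cast L j) ⟩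
  c ∎
  where
  open ≡-Reasoning
  L = length-replicate d

module EdgeGraph {n M : ℕ} (endpoint : Fin M ⊎ Fin M → Fin n)
                 (loopless : ∀ i → endpoint (inj₁ i) ≢ endpoint (inj₂ i)) where

  edgeList : List (Fin n × Fin n)
  edgeList = tabulate (λ i → endpoint (inj₁ i) , endpoint (inj₂ i))

  length-edgeList : length edgeList ≡ M
  length-edgeList = length-tabulate _

  lookup-edgeList : ∀ i → let i′ = cast length-edgeList i in
                    lookup edgeList i ≡ (endpoint (inj₁ i′) , endpoint (inj₂ i′))
  lookup-edgeList i = begin
    lookup edgeList i                         ≡⟨ cong (lookup edgeList) (cast-involutive (sym L) L i) ⟨
    lookup edgeList (cast (sym L) (cast L i)) ≡⟨ lookup-tabulate _ (cast L i) ⟩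
    _                                         ∎
    where
    open ≡-Reasoning
    L = length-edgeList

  graph : Graph n
  graph = record
    { edges    = edgeList
    ; loopless = λ i e → loopless (cast length-edgeList i)
        (trans (sym (cong proj₁ (lookup-edgeList i))) (trans e (cong proj₂ (lookup-edgeList i))))
    }

  open Graph graph using (HalfEdge; HalfEdgesAt) renaming (endpoint to graph-endpoint)

  halfEdge↔ : HalfEdge ↔ (Fin M ⊎ Fin M)
  halfEdge↔ = mk↔ₛ′ to from to∘from from∘to
    where
    L = length-edgeList
    to : HalfEdge → Fin M ⊎ Fin M
    to (i , false) = inj₁ (cast L i)
    to (i , true)  = inj₂ (cast L i)
    from : Fin M ⊎ Fin M → HalfEdge
    from (inj₁ i) = cast (sym L) i , false
    from (inj₂ i) = cast (sym L) i , true
    to∘from : ∀ s → to (from s) ≡ s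
    to∘from (inj₁ i) = cong inj₁ (cast-involutive L (sym L) i)
    to∘from (inj₂ i) = cong inj₂ (cast-involutive L (sym L) i)
    from∘to : ∀ h → from (to h) ≡ h
    from∘to (i , false) = cong (_, false) (cast-involutive (sym L) L i)
    from∘to (i , true)  = cong (_, true) (cast-involutive (sym L) L i)

  endpoint-halfEdge↔ : ∀ h → graph-endpoint h ≡ endpoint (Inverse.to halfEdge↔ h)
  endpoint-halfEdge↔ (i , false) = cong proj₁ (lookup-edgeList i)
  endpoint-halfEdge↔ (i , true)  = cong proj₂ (lookup-edgeList i)

  halfEdgesAt↔ : ∀ v → HalfEdgesAt v ↔ Fiber endpoint v
  halfEdgesAt↔ v = fiber-reindex halfEdge↔ endpoint-halfEdge↔

complementary-ends : ∀ {c d} ℓ → c ≡ (ℓ , false) → d ≡ (ℓ , true) → Complementary c d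
complementary-ends ℓ refl refl = refl , refl

realizesOrder-bipartite :
  (ℓ : ℕ) (P : Pot) {n M : ℕ} (endpoint : Fin M ⊎ Fin M → Fin n) (colour : Fin n → Bool) →
  (∀ i → colour (endpoint (inj₁ i)) ≡ false) → (∀ i → colour (endpoint (inj₂ i)) ≡ true) →
  (degree : Fin n → ℕ) → (∀ v → replicate (degree v) (ℓ , colour v) ∈ P) →
  (∀ v → Fin (degree v) ↔ Fiber endpoint v) → RealizesOrder P n
realizesOrder-bipartite ℓ P {n} endpoint colour first-false second-true degree tile∈P ends =
  graph , record
    { tile          = tile
    ; tile∈P        = tile∈P
    ; assign        = λ v →
        ↔-sym (halfEdgesAt↔ v) ↔-∘ (ends v ↔-∘ cast↔ (length-replicate (degree v)))
    ; complementary = λ i → complementary-ends ℓ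
        (trans (lookup-tile _ _) (cong (ℓ ,_) (colour-end (i , false) (first-false _))))
        (trans (lookup-tile _ _) (cong (ℓ ,_) (colour-end (i , true) (second-true _))))
    }
  where
  loopless : ∀ i → endpoint (inj₁ i) ≢ endpoint (inj₂ i)
  loopless i e = false≢true (trans (sym (first-false i)) (trans (cong colour e) (second-true i)))
    where
    false≢true : false ≢ true
    false≢true ()
  open EdgeGraph endpoint loopless
  tile : Fin n → Tile
  tile v = replicate (degree v) (ℓ , colour v)
  lookup-tile : ∀ v j → lookup (tile v) j ≡ (ℓ , colour v)
  lookup-tile v = lookup-replicate′ (degree v) (ℓ , colour v)
  colour-end : ∀ h {b} → colour (endpoint (Inverse.to halfEdge↔ h)) ≡ b →
               colour (Graph.endpoint graph h) ≡ b
  colour-end h = trans (cong colour (endpoint-halfEdge↔ h))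

module _ where

  open import Data.Nat using (_+_; _*_)

  module TileCountGraph {e₁ e₂ x y z : ℕ} (balance : x * e₁ ≡ y * e₂ + z) where

    pot : Pot
    pot = aTile e₁ ∷ âTile e₂ ∷ âTile 1 ∷ []

    Vertex : Set
    Vertex = Fin x ⊎ (Fin y ⊎ Fin z)

    vertex↔ : Fin (x + (y + z)) ↔ Vertex
    vertex↔ = (↔-id (Fin x) ⊎-↔ +↔⊎) ↔-∘ +↔⊎

    degree : Vertex → ℕ
    degree (inj₁ _)        = e₁
    degree (inj₂ (inj₁ _)) = e₂
    degree (inj₂ (inj₂ _)) = 1

    colour : Vertex → Bool
    colour (inj₁ _) = false
    colour (inj₂ _) = true

    tile∈pot : ∀ s → replicate (degree s) (a , colour s) ∈ pot
    tile∈pot (inj₁ _)        = here refl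
    tile∈pot (inj₂ (inj₁ _)) = there (here refl)
    tile∈pot (inj₂ (inj₂ _)) = there (there (here refl))

    âEnd↔ : Fin (x * e₁) ↔ (Fin (y * e₂) ⊎ Fin z)
    âEnd↔ = +↔⊎ ↔-∘ cast↔ balance

    âOwner : Fin (y * e₂) ⊎ Fin z → Fin y ⊎ Fin z
    âOwner = ⊎-map (quotient e₂) id

    -- Edge i joins the i-th a-end to the i-th â-end, ends being numbered tile by tile.
    owner : Fin (x * e₁) ⊎ Fin (x * e₁) → Vertex
    owner = ⊎-map (quotient e₁) (âOwner ∘ Inverse.to âEnd↔)

    fiber-âOwner : ∀ w → Fin (degree (inj₂ w)) ↔ Fiber âOwner w
    fiber-âOwner (inj₁ u) = ↔-sym (fiber-quotient e₂ u ↔-∘ fiber-⊎-map (inj₁ u))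
    fiber-âOwner (inj₂ t) = ↔-sym (fiber-id t ↔-∘ fiber-⊎-map (inj₂ t))

    fiber-owner : ∀ s → Fin (degree s) ↔ Fiber owner s
    fiber-owner (inj₁ j) = ↔-sym (fiber-quotient e₁ j ↔-∘ fiber-⊎-map (inj₁ j))
    fiber-owner (inj₂ w) = begin
      Fin (degree (inj₂ w))                        ↔⟨ fiber-âOwner w ⟩
      Fiber âOwner w                               ↔⟨ fiber-reindex âEnd↔ (λ _ → refl) ⟨
      Fiber (âOwner ∘ Inverse.to âEnd↔) w          ↔⟨ fiber-⊎-map (inj₂ w) ⟨
      Fiber owner (inj₂ w)                         ∎
      where open EquationalReasoning

    endpoint : Fin (x * e₁) ⊎ Fin (x * e₁) → Fin (x + (y + z))
    endpoint = Inverse.from vertex↔ ∘ owner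

    colour-endpoint : ∀ h → colour (Inverse.to vertex↔ (endpoint h)) ≡ colour (owner h)
    colour-endpoint h = cong colour (Inverse.strictlyInverseˡ vertex↔ (owner h))

    realizes : RealizesOrder pot (x + (y + z))
    realizes = realizesOrder-bipartite a pot endpoint
      (colour ∘ Inverse.to vertex↔) (colour-endpoint ∘ inj₁) (colour-endpoint ∘ inj₂)
      (degree ∘ Inverse.to vertex↔) (tile∈pot ∘ Inverse.to vertex↔)
      (λ v → ↔-sym (fiber-from∘ vertex↔) ↔-∘ fiber-owner (Inverse.to vertex↔ v))

  realizesOrder-tileCounts : ∀ {e₁ e₂ n} → TileCounts e₁ e₂ n →
                             RealizesOrder (aTile e₁ ∷ âTile e₂ ∷ âTile 1 ∷ []) n
  realizesOrder-tileCounts record { x = x ; y = y ; z = z ; order = order ; balance = balance } =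
    subst (RealizesOrder _) (sym order) (TileCountGraph.realizes {x = x} {y} {z} balance)

open import Data.Integer using (ℤ; +_; -[1+_]; +<+; _+_; _-_; _*_; _≤_; _<_; ∣_∣)
open import Data.Integer.GCD using (gcd)
open import Data.Integer.Properties using (pos-*; drop‿+≤+)
import Data.Nat as ℕ
import Data.Nat.GCD as ℕ
import Data.Nat.Properties as ℕ

bound-ℕ : ∀ e₁ e₂ n → (+ e₁ + + 1) * (+ e₁ + + e₂) ≤ + n * + e₁ →
          suc e₁ ℕ.* (e₁ ℕ.+ e₂) ℕ.≤ n ℕ.* e₁
bound-ℕ e₁ e₂ n bound = subst (λ m → m ℕ.* (e₁ ℕ.+ e₂) ℕ.≤ n ℕ.* e₁) (ℕ.+-comm e₁ 1)
  (drop‿+≤+ (subst₂ _≤_ (sym (pos-* (e₁ ℕ.+ 1) (e₁ ℕ.+ e₂))) (sym (pos-* n e₁)) bound))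

gcd≡1⇒coprime-suc : ∀ e k → gcd (+ e + + 1) (+ 1 - + suc (suc k)) ≡ + 1 →
                    Coprime (suc e) (suc k)
gcd≡1⇒coprime-suc e k gcd≡1 =
  gcd≡1⇒coprime (subst (λ m → ℕ.gcd m (suc k) ≡ 1) (ℕ.+-comm e 1) (cong ∣_∣ gcd≡1))

theorem2 : (e₁ e₂ : ℤ) → e₂ ≤ e₁ → + 1 < e₂ →
    gcd (e₁ + + 1) (+ 1 - e₂) ≡ + 1 →
    (n : ℕ) →
    (e₁ + + 1) * (e₁ + e₂) ≤ + n * e₁ →
    (e₂ - + 1) * (e₁ + e₂) ≤ + n * e₂ →
    RealizesOrder (aTile ∣ e₁ ∣ ∷ âTile ∣ e₂ ∣ ∷ âTile 1 ∷ []) n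
theorem2 (+ e₁) (+ suc (suc k)) _ _ gcd≡1 n bound _ = realizesOrder-tileCounts
  (tileCounts n (gcd≡1⇒coprime-suc e₁ k gcd≡1) (bound-ℕ e₁ (suc (suc k)) n bound))
theorem2 -[1+ _ ] (+ _)    ()  _ _ _ _ _
theorem2 _        -[1+ _ ] _   () _ _ _ _
theorem2 (+ _)    (+ 0)    _   (+<+ ()) _ _ _ _
theorem2 (+ _)    (+ 1)    _   (+<+ (s≤s ())) _ _ _ _
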